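{- Let $S$ and $S'$ be two graphs, each on the same number $n\ge 2$ of vertices and each satisfying the hypotheses described in the context, with $|\Pi_1(S)|=|\Pi_1(S')|$. Then the flipping groups $\mathbf W(S)$ and $\mathbf W(S')$ are isomorphic. That is, the flipping group is unique up to isomorphism among such graphs with a given value of $|\Pi_1|$.
   Context: A graph $S$ satisfies the hypotheses if it is a finite simple connected graph with vertex set $\{s_1,\dots,s_n\}$ and edge set $R$ such that $s_1,\dots,s_{n-1}$ is an induced path. The neighbours of $s_n$ are some $s_{j_1},\dots,s_{j_m}$ with $1\le j_1<\dots<j_m\le n-1$. $\widetilde s$ is the characteristic vector in $F_2^n$ (coordinates indexed by vertices) of vertex $s$. The flipping move of $s$ is $\mathbf s\in\mathrm{Mat}_n(F_2)$ with $\mathbf s_{ab}=1$ if $a=b$, or if $b=s$ and $ab\in R$, and $0$ otherwise. The flipping group $\mathbf W(S)$ is the subgroup of $\mathrm{GL}_n(F_2)$ generated by $\mathbf{s_1},\dots,\mathbf{s_n}$. $\overline1=\widetilde s_1$ and $\overline{i+1}=\mathbf{s_i}\cdots\mathbf{s_1}\overline1$ for $1\le i\le n-1$. $\Pi=\{\overline1,\dots,\overline n\}$, $\Pi_0=\{\overline i\in\Pi:\langle\overline i,\widetilde s_n\rangle=0\}$ (dot product over $F_2$), and $\Pi_1(S)=\Pi\setminus\Pi_0$. -}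

module Defs where

open import Data.Bool using (Bool; true; false; _∧_; _∨_; _xor_; not; if_then_else_)
open import Data.Nat using (ℕ; zero; suc; _∸_; _<_; _≤_; _≡ᵇ_)
open import Data.Fin using (Fin; toℕ)
open import Data.List using (List; []; _∷_; foldr; map; filterᵇ; length; upTo)
open import Data.Bool.ListAction using (any)
open import Data.Vec using (Vec; []; _∷_; tabulate; lookup; allFin; toList)
open import Data.Product using (Σ; _×_; _,_; ∃)
open import Data.Sum using (_⊎_)
open import Function.Base using (_∘_)
open import Relation.Binary.PropositionalEquality using (_≡_)

F2Vec : ℕ → Set
F2Vec n = Vec Bool n

Mat : ℕ → Set
Mat n = Vec (Vec Bool n) n

entry : ∀ {n} → Mat n → Fin n → Fin n → Bool
entry M a b = lookup (lookup M a) b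

Σ₂ : ∀ {n} → (Fin n → Bool) → Bool
Σ₂ {n} f = foldr (λ i acc → f i xor acc) false (toList (allFin n))

dot : ∀ {n} → F2Vec n → F2Vec n → Bool
dot u v = Σ₂ (λ i → lookup u i ∧ lookup v i)

_*M_ : ∀ {n} → Mat n → Mat n → Mat n
A *M B = tabulate (λ a → tabulate (λ c → Σ₂ (λ b → entry A a b ∧ entry B b c)))

_·V_ : ∀ {n} → Mat n → F2Vec n → F2Vec n
A ·V v = tabulate (λ a → Σ₂ (λ b → entry A a b ∧ lookup v b))

idM : ∀ {n} → Mat n
idM = tabulate (λ a → tabulate (λ b → toℕ a ≡ᵇ toℕ b))

prodM : ∀ {n} → List (Mat n) → Mat n
prodM = foldr _*M_ idM

-- Finite simple graphs on the vertex set Fin n; vertex s_i is the index i-1.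

record Graph (n : ℕ) : Set where
  field
    adj     : Fin n → Fin n → Bool
    adj-sym : ∀ a b → adj a b ≡ adj b a
    adj-irr : ∀ a → adj a a ≡ false
open Graph public

data Reach {n : ℕ} (G : Graph n) : Fin n → Fin n → Set where
  here : ∀ {a} → Reach G a a
  step : ∀ {a b c} → adj G a b ≡ true → Reach G b c → Reach G a c

Connected : ∀ {n} → Graph n → Set
Connected {n} G = ∀ (a b : Fin n) → Reach G a b

InducedPathPrefix : ∀ {n} → Graph n → Set
InducedPathPrefix {n} G =
  ∀ (a b : Fin n) → suc (toℕ a) < n → suc (toℕ b) < n →
    (adj G a b ≡ true → (toℕ a ≡ suc (toℕ b) ⊎ toℕ b ≡ suc (toℕ a))) ×
    ((toℕ a ≡ suc (toℕ b) ⊎ toℕ b ≡ suc (toℕ a)) → adj G a b ≡ true)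

-- the hypotheses of the context (simplicity/finiteness are built into Graph n)
Hyp : ∀ {n} → Graph n → Set
Hyp G = Connected G × InducedPathPrefix G

flipℕ : ∀ {n} → Graph n → ℕ → Mat n
flipℕ G k = tabulate (λ a → tabulate (λ b →
  (toℕ a ≡ᵇ toℕ b) ∨ ((toℕ b ≡ᵇ k) ∧ adj G a b)))

flipMove : ∀ {n} → Graph n → Fin n → Mat n
flipMove G s = flipℕ G (toℕ s)

-- membership in W(S): M is a product of flipping moves.
-- (W(S) is finite and the generators are invertible, so the submonoid
--  generated equals the subgroup generated.)
InW : ∀ {n} → Graph n → Mat n → Set
InW {n} G M = Σ (List (Fin n)) (λ w → prodM (map (flipMove G) w) ≡ M)

Isomorphic : ∀ {n} → Graph n → Graph n → Set
Isomorphic {n} G H =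
  Σ (Mat n → Mat n) λ f →
    (∀ M → InW G M → InW H (f M)) ×
    (∀ M N → InW G M → InW G N → f (M *M N) ≡ f M *M f N) ×
    (∀ M N → InW G M → InW G N → f M ≡ f N → M ≡ N) ×
    (∀ P → InW H P → Σ (Mat n) λ M → InW G M × f M ≡ P)

charVec : ∀ {n} → ℕ → F2Vec n
charVec k = tabulate (λ a → toℕ a ≡ᵇ k)

-- barℕ k = \overline{k+1}:  \bar 1 = s̃_1,  \overline{i+1} = s_i ⋯ s_1 \bar 1
barℕ : ∀ {n} → Graph n → ℕ → F2Vec n
barℕ G zero    = charVec 0
barℕ G (suc k) = flipℕ G k ·V barℕ G k

eqV : ∀ {n} → F2Vec n → F2Vec n → Bool
eqV [] [] = true
eqV (x ∷ u) (y ∷ v) = (if x then y else not y) ∧ eqV u v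

-- |Π₁(S)|: number of distinct elements of Π = {\bar 1, …, \bar n} having
-- ⟨\bar i, s̃_n⟩ = 1.  Each element is counted at its first occurrence.
Pi1Card : ∀ {n} → Graph n → ℕ
Pi1Card {n} G = length (filterᵇ keep (upTo n))
  where
    keep : ℕ → Bool
    keep k = dot (barℕ G k) (charVec (n ∸ 1))
             ∧ not (any (λ j → eqV (barℕ G j) (barℕ G k)) (upTo k))

-- Every graph S satisfying the hypotheses is determined by the neighbourhood of s_n, or equivalently by
-- its parity vector (c_1, …, c_{n-1}), c_k = ⟨ \overline{k+1} , s̃_n ⟩: s_n is adjacent to s_{k+1} iff
-- c_k ≠ c_{k+1} (where c_0 = 0).  Indeed \overline{k+1} = s̃_k + s̃_{k+1} + c_k s̃_n, with s̃_0 = 0 and no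
-- s̃_{k+1} term for k + 1 = n; so each \overline{k+1} with c_k = 1 differs from the earlier ones, and
-- |Π₁(S)| is the number of ones among the c_k.
-- If s_j is adjacent to s_n, adding the neighbourhood of s_j to that of s_n swaps the different entries
-- c_{j-1} and c_j, and conjugation by the transvection I + e_n e_jᵀ maps W(S) onto the flipping group of
-- the new graph, sending s_n to s_j s_n s_j and fixing the other generators.  Adjacent swaps connect any
-- two parity vectors with the same number of ones.
module Submission where

open import Defs
open import Algebra.Bundles using (CommutativeRing)
open import Data.Bool using (Bool; true; false; _∧_; _∨_; _xor_; not; if_then_else_; T?)
open import Data.Bool.ListAction using (any)
open import Data.Bool.Properties
  using ( xor-∧-commutativeRing; xor-identityʳ; xor-inverseʳ; ∧-identityʳ; ∧-zeroʳ; ∧-comm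
        ; ∧-assoc; ∨-identityʳ; T-≡; ¬-not )
open import Data.Empty using (⊥-elim)
open import Data.Fin using (Fin; zero; suc; toℕ; fromℕ; fromℕ<; _≟_)
open import Data.Fin.Properties using (toℕ-injective; toℕ-fromℕ; toℕ-fromℕ<; toℕ≤pred[n])
open import Data.List
  using (List; []; _∷_; _++_; foldr; map; concatMap; length; filterᵇ; applyUpTo; upTo)
open import Data.List.Properties using (map-++; map-cong)
open import Data.List.Relation.Unary.Any.Properties using (any⁻; applyUpTo⁻)
open import Data.Maybe using (Maybe; just; nothing)
open import Data.Nat using (ℕ; zero; suc; pred; _≡ᵇ_; _<_; _≤_; z≤n; s≤s; s≤s⁻¹)
open import Data.Nat.Properties
  using ( ≡ᵇ⇒≡; ≡⇒≡ᵇ; <⇒≢; <⇒≤; ≤∧≢⇒<; <-≤-trans; ≤-refl; n<1+n; n≤1+n; m<n⇒m<1+n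
        ; m≤n⇒m≤1+n; m≤n⇒m<n∨m≡n )
open import Data.Product using (_,_; proj₁; proj₂; _×_; ∃-syntax)
open import Data.Sum using (_⊎_; inj₁; inj₂)
import Data.Sum as Sum
open import Data.Vec using (Vec; []; _∷_; tabulate; lookup; toList; countᵇ)
open import Data.Vec.Properties using (lookup∘tabulate; tabulate∘lookup; tabulate-cong; count≤n)
open import Function.Base using (_∘_; id)
open import Function.Bundles using (Equivalence)
open import Relation.Binary.Construct.Closure.ReflexiveTransitive using (Star; ε; _◅_; _◅◅_)
import Relation.Binary.Construct.Closure.ReflexiveTransitive as Star
open import Relation.Binary.PropositionalEquality
open import Relation.Nullary using (yes; no)
open import Tactic.RingSolver using (solve-∀)
open import Tactic.RingSolver.Core.AlmostCommutativeRing using (AlmostCommutativeRing; fromCommutativeRing)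

open CommutativeRing xor-∧-commutativeRing using (semiring)
open import Algebra.Properties.Semiring.Sum semiring
  using (sum; sum-cong-≗; sum-replicate-zero; ∑-comm; ∑-distrib-+; *-distribˡ-sum; *-distribʳ-sum)

-- Its coefficients live in F₂ itself, so the ring solver also proves identities relying on x xor x = false.
F₂ : AlmostCommutativeRing _ _
F₂ = fromCommutativeRing xor-∧-commutativeRing isFalse
  where
  isFalse : ∀ x → Maybe (false ≡ x)
  isFalse false = just refl
  isFalse true  = nothing

xor-cancelʳ : ∀ x y → (x xor y) xor y ≡ x
xor-cancelʳ = solve-∀ F₂

⇔⇒≡ : ∀ {b c : Bool} → (b ≡ true → c ≡ true) → (c ≡ true → b ≡ true) → b ≡ c
⇔⇒≡ {true}  {true}  _   _   = refl
⇔⇒≡ {true}  {false} b⇒c _   = sym (b⇒c refl)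
⇔⇒≡ {false} {true}  _   c⇒b = c⇒b refl
⇔⇒≡ {false} {false} _   _   = refl

false-true-≢ : ∀ {u v : Bool} → u ≡ false → v ≡ true → u ≢ v
false-true-≢ refl refl ()

≡ᵇ-refl : ∀ n → (n ≡ᵇ n) ≡ true
≡ᵇ-refl n = Equivalence.to T-≡ (≡⇒≡ᵇ n n refl)

≡ᵇ-true⇒≡ : ∀ {m n} → (m ≡ᵇ n) ≡ true → m ≡ n
≡ᵇ-true⇒≡ {m} {n} e = ≡ᵇ⇒≡ m n (Equivalence.from T-≡ e)

≢⇒≡ᵇ-false : ∀ {m n} → m ≢ n → (m ≡ᵇ n) ≡ false
≢⇒≡ᵇ-false m≢n = ¬-not (m≢n ∘ ≡ᵇ-true⇒≡)

≡ᵇ-false⇒≢ : ∀ {m n} → (m ≡ᵇ n) ≡ false → m ≢ n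
≡ᵇ-false⇒≢ {m} e refl with trans (sym (≡ᵇ-refl m)) e
... | ()

-- Linear algebra over F₂

Σ₂≡sum : ∀ {n} (f : Fin n → Bool) → Σ₂ f ≡ sum f
Σ₂≡sum {n} f = foldr-tabulate id
  where
  foldr-tabulate : ∀ {m} (h : Fin m → Fin n) →
    foldr (λ i acc → f i xor acc) false (toList (tabulate h)) ≡ sum (f ∘ h)
  foldr-tabulate {zero}  h = refl
  foldr-tabulate {suc m} h = cong (f (h zero) xor_) (foldr-tabulate (h ∘ suc))

δ : ∀ {n} → Fin n → Fin n → Bool
δ a b = toℕ a ≡ᵇ toℕ b

δ-refl : ∀ {n} (a : Fin n) → δ a a ≡ true
δ-refl zero    = refl
δ-refl (suc a) = δ-refl a

δ-≢ : ∀ {n} {a b : Fin n} → a ≢ b → δ a b ≡ false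
δ-≢ {a = zero}  {zero}  a≢b = ⊥-elim (a≢b refl)
δ-≢ {a = zero}  {suc b} _   = refl
δ-≢ {a = suc a} {zero}  _   = refl
δ-≢ {a = suc a} {suc b} a≢b = δ-≢ (a≢b ∘ cong suc)

δ-sym : ∀ {n} (a b : Fin n) → δ a b ≡ δ b a
δ-sym zero    zero    = refl
δ-sym zero    (suc b) = refl
δ-sym (suc a) zero    = refl
δ-sym (suc a) (suc b) = δ-sym a b

sum-δ-∧ : ∀ {n} (i : Fin n) (g : Fin n → Bool) → sum (λ b → δ i b ∧ g b) ≡ g i
sum-δ-∧ {suc n} zero    g = trans (cong (g zero xor_) (sum-replicate-zero n)) (xor-identityʳ (g zero))
sum-δ-∧ {suc n} (suc i) g = sum-δ-∧ i (g ∘ suc)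

sum-∧-δ : ∀ {n} (i : Fin n) (g : Fin n → Bool) → sum (λ b → g b ∧ δ b i) ≡ g i
sum-∧-δ i g = trans (sum-cong-≗ λ b → trans (∧-comm (g b) (δ b i)) (cong (_∧ g b) (δ-sym b i)))
                    (sum-δ-∧ i g)

⟨_,_⟩ : ∀ {n} → (Fin n → Bool) → (Fin n → Bool) → Bool
⟨ u , v ⟩ = sum (λ c → u c ∧ v c)

⟨δ_,_⟩ : ∀ {n} (i : Fin n) (v : Fin n → Bool) → ⟨ δ i , v ⟩ ≡ v i
⟨δ i , v ⟩ = sum-δ-∧ i v

⟨δ,δ⟩-≢ : ∀ {n} {i j : Fin n} → i ≢ j → ⟨ δ i , δ j ⟩ ≡ false
⟨δ,δ⟩-≢ {i = i} {j} i≢j = trans ⟨δ i , δ j ⟩ (δ-≢ (i≢j ∘ sym))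

⟨⟩-linearʳ : ∀ {n} (w y u : Fin n → Bool) s →
  ⟨ w , (λ c → y c xor (u c ∧ s)) ⟩ ≡ ⟨ w , y ⟩ xor (⟨ w , u ⟩ ∧ s)
⟨⟩-linearʳ w y u s = begin
  sum (λ c → w c ∧ (y c xor (u c ∧ s)))
    ≡⟨ sum-cong-≗ (λ c → distrib (w c) (y c) (u c) s) ⟩
  sum (λ c → (w c ∧ y c) xor ((w c ∧ u c) ∧ s))
    ≡⟨ ∑-distrib-+ (λ c → w c ∧ y c) (λ c → (w c ∧ u c) ∧ s) ⟩
  ⟨ w , y ⟩ xor sum (λ c → (w c ∧ u c) ∧ s)
    ≡⟨ cong (⟨ w , y ⟩ xor_) (sym (*-distribʳ-sum s (λ c → w c ∧ u c))) ⟩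
  ⟨ w , y ⟩ xor (⟨ w , u ⟩ ∧ s) ∎
  where
  open ≡-Reasoning
  distrib : ∀ w y u s → w ∧ (y xor (u ∧ s)) ≡ (w ∧ y) xor ((w ∧ u) ∧ s)
  distrib = solve-∀ F₂

infix 4 _HasEntries_

_HasEntries_ : ∀ {n} → Mat n → (Fin n → Fin n → Bool) → Set
M HasEntries f = ∀ a b → entry M a b ≡ f a b

tabulate-HasEntries : ∀ {n} (f : Fin n → Fin n → Bool) → tabulate (λ a → tabulate (f a)) HasEntries f
tabulate-HasEntries f a b = trans (cong (λ r → lookup r b) (lookup∘tabulate _ a)) (lookup∘tabulate _ b)

idM-HasEntries : ∀ {n} → idM {n} HasEntries δ
idM-HasEntries = tabulate-HasEntries δ

*M-entry : ∀ {n} (A B : Mat n) a c → entry (A *M B) a c ≡ sum (λ b → entry A a b ∧ entry B b c)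
*M-entry A B a c = trans (tabulate-HasEntries _ a c) (Σ₂≡sum (λ b → entry A a b ∧ entry B b c))

Mat-ext : ∀ {n} {M N : Mat n} → M HasEntries entry N → M ≡ N
Mat-ext {M = M} {N} M≗N =
  trans (sym (rows M)) (trans (tabulate-cong λ a → tabulate-cong (M≗N a)) (rows N))
  where
  rows : ∀ L → tabulate (λ a → tabulate (entry L a)) ≡ L
  rows L = trans (tabulate-cong λ a → tabulate∘lookup (lookup L a)) (tabulate∘lookup L)

HasEntries-unique : ∀ {n} {M N : Mat n} {f g} → M HasEntries f → N HasEntries g →
  (∀ a b → f a b ≡ g a b) → M ≡ N
HasEntries-unique M≗f N≗g f≗g = Mat-ext λ a b → trans (M≗f a b) (trans (f≗g a b) (sym (N≗g a b)))

*M-assoc : ∀ {n} (A B C : Mat n) → (A *M B) *M C ≡ A *M (B *M C)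
*M-assoc {n} A B C = Mat-ext λ a d → begin
  entry ((A *M B) *M C) a d
    ≡⟨ *M-entry (A *M B) C a d ⟩
  sum (λ c → entry (A *M B) a c ∧ C′ c d)
    ≡⟨ sum-cong-≗ (λ c → cong (_∧ C′ c d) (*M-entry A B a c)) ⟩
  sum (λ c → sum (λ b → A′ a b ∧ B′ b c) ∧ C′ c d)
    ≡⟨ sum-cong-≗ (λ c → *-distribʳ-sum (C′ c d) (λ b → A′ a b ∧ B′ b c)) ⟩
  sum (λ c → sum (λ b → (A′ a b ∧ B′ b c) ∧ C′ c d))
    ≡⟨ ∑-comm (λ c b → (A′ a b ∧ B′ b c) ∧ C′ c d) ⟩
  sum (λ b → sum (λ c → (A′ a b ∧ B′ b c) ∧ C′ c d))
    ≡⟨ sum-cong-≗ (λ b → sum-cong-≗ (λ c → ∧-assoc (A′ a b) (B′ b c) (C′ c d))) ⟩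
  sum (λ b → sum (λ c → A′ a b ∧ (B′ b c ∧ C′ c d)))
    ≡⟨ sum-cong-≗ (λ b → sym (*-distribˡ-sum (A′ a b) (λ c → B′ b c ∧ C′ c d))) ⟩
  sum (λ b → A′ a b ∧ sum (λ c → B′ b c ∧ C′ c d))
    ≡⟨ sum-cong-≗ (λ b → cong (A′ a b ∧_) (sym (*M-entry B C b d))) ⟩
  sum (λ b → A′ a b ∧ entry (B *M C) b d)
    ≡⟨ sym (*M-entry A (B *M C) a d) ⟩
  entry (A *M (B *M C)) a d ∎
  where
  open ≡-Reasoning
  A′ B′ C′ : Fin n → Fin n → Bool
  A′ = entry A
  B′ = entry B
  C′ = entry C

*M-identityˡ : ∀ {n} (A : Mat n) → idM *M A ≡ A
*M-identityˡ A = Mat-ext λ a b → begin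
  entry (idM *M A) a b                     ≡⟨ *M-entry idM A a b ⟩
  sum (λ c → entry idM a c ∧ entry A c b)
    ≡⟨ sum-cong-≗ (λ c → cong (_∧ entry A c b) (idM-HasEntries a c)) ⟩
  sum (λ c → δ a c ∧ entry A c b)          ≡⟨ sum-δ-∧ a (λ c → entry A c b) ⟩
  entry A a b                              ∎
  where open ≡-Reasoning

*M-identityʳ : ∀ {n} (A : Mat n) → A *M idM ≡ A
*M-identityʳ A = Mat-ext λ a b → begin
  entry (A *M idM) a b                     ≡⟨ *M-entry A idM a b ⟩
  sum (λ c → entry A a c ∧ entry idM c b)
    ≡⟨ sum-cong-≗ (λ c → cong (entry A a c ∧_) (idM-HasEntries c b)) ⟩
  sum (λ c → entry A a c ∧ δ c b)          ≡⟨ sum-∧-δ b (entry A a) ⟩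
  entry A a b                              ∎
  where open ≡-Reasoning

prodM-++ : ∀ {n} (xs ys : List (Mat n)) → prodM (xs ++ ys) ≡ prodM xs *M prodM ys
prodM-++ []       ys = sym (*M-identityˡ (prodM ys))
prodM-++ (x ∷ xs) ys = trans (cong (x *M_) (prodM-++ xs ys)) (sym (*M-assoc x (prodM xs) (prodM ys)))

transvection : ∀ {n} → (Fin n → Bool) → (Fin n → Bool) → Fin n → Fin n → Bool
transvection u v a b = δ a b xor (u a ∧ v b)

transvection-cong : ∀ {n} {u u′ v v′ : Fin n → Bool} →
  (∀ a → u a ≡ u′ a) → (∀ b → v b ≡ v′ b) → ∀ a b → transvection u v a b ≡ transvection u′ v′ a b
transvection-cong u≗u′ v≗v′ a b = cong (δ a b xor_) (cong₂ _∧_ (u≗u′ a) (v≗v′ b))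

transvection-applyʳ : ∀ {n} (u v z : Fin n → Bool) c →
  sum (λ d → transvection u v c d ∧ z d) ≡ z c xor (u c ∧ ⟨ v , z ⟩)
transvection-applyʳ u v z c = begin
  sum (λ d → (δ c d xor (u c ∧ v d)) ∧ z d)
    ≡⟨ sum-cong-≗ (λ d → distrib (δ c d) (u c) (v d) (z d)) ⟩
  sum (λ d → (δ c d ∧ z d) xor (u c ∧ (v d ∧ z d)))
    ≡⟨ ∑-distrib-+ (λ d → δ c d ∧ z d) (λ d → u c ∧ (v d ∧ z d)) ⟩
  sum (λ d → δ c d ∧ z d) xor sum (λ d → u c ∧ (v d ∧ z d))
    ≡⟨ cong₂ _xor_ (sum-δ-∧ c z) (sym (*-distribˡ-sum (u c) (λ d → v d ∧ z d))) ⟩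
  z c xor (u c ∧ ⟨ v , z ⟩) ∎
  where
  open ≡-Reasoning
  distrib : ∀ e u v z → (e xor (u ∧ v)) ∧ z ≡ (e ∧ z) xor (u ∧ (v ∧ z))
  distrib = solve-∀ F₂

transvection-applyˡ : ∀ {n} (w u v : Fin n → Bool) b →
  sum (λ c → w c ∧ transvection u v c b) ≡ w b xor (⟨ w , u ⟩ ∧ v b)
transvection-applyˡ w u v b = begin
  sum (λ c → w c ∧ (δ c b xor (u c ∧ v b)))
    ≡⟨ ⟨⟩-linearʳ w (λ c → δ c b) u (v b) ⟩
  sum (λ c → w c ∧ δ c b) xor (⟨ w , u ⟩ ∧ v b)
    ≡⟨ cong (_xor (⟨ w , u ⟩ ∧ v b)) (sum-∧-δ b w) ⟩
  w b xor (⟨ w , u ⟩ ∧ v b) ∎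
  where open ≡-Reasoning

transvection-squared : ∀ {n} {P : Mat n} (p q : Fin n → Bool) → P HasEntries transvection p q →
  P *M P HasEntries λ a b → transvection p q a b xor (p a ∧ (q b xor (⟨ q , p ⟩ ∧ q b)))
transvection-squared {P = P} p q P≗T a b = begin
  entry (P *M P) a b
    ≡⟨ *M-entry P P a b ⟩
  sum (λ c → entry P a c ∧ entry P c b)
    ≡⟨ sum-cong-≗ (λ c → cong₂ _∧_ (P≗T a c) (P≗T c b)) ⟩
  sum (λ c → transvection p q a c ∧ transvection p q c b)
    ≡⟨ transvection-applyʳ p q (λ c → transvection p q c b) a ⟩
  transvection p q a b xor (p a ∧ sum (λ c → q c ∧ transvection p q c b))
    ≡⟨ cong (λ t → transvection p q a b xor (p a ∧ t)) (transvection-applyˡ q p q b) ⟩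
  transvection p q a b xor (p a ∧ (q b xor (⟨ q , p ⟩ ∧ q b))) ∎
  where open ≡-Reasoning

transvection-involutive : ∀ {n} {P : Mat n} (p q : Fin n → Bool) →
  P HasEntries transvection p q → ⟨ q , p ⟩ ≡ false → P *M P ≡ idM
transvection-involutive {P = P} p q P≗T q⊥p =
  HasEntries-unique (transvection-squared {P = P} p q P≗T) idM-HasEntries λ a b →
  trans (cong (λ t → transvection p q a b xor (p a ∧ (q b xor (t ∧ q b)))) q⊥p)
        (cancel (δ a b) (p a) (q b))
  where
  cancel : ∀ e x y → (e xor (x ∧ y)) xor (x ∧ (y xor (false ∧ y))) ≡ e
  cancel = solve-∀ F₂

conjugate-transvection : ∀ {n} {P M : Mat n} (p q u v : Fin n → Bool) →
  P HasEntries transvection p q → M HasEntries transvection u v → ⟨ q , p ⟩ ≡ false →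
  P *M (M *M P) HasEntries
    transvection (λ a → u a xor (⟨ q , u ⟩ ∧ p a)) (λ b → v b xor (⟨ v , p ⟩ ∧ q b))
conjugate-transvection {P = P} {M} p q u v P≗T M≗T q⊥p a b = begin
  entry (P *M (M *M P)) a b
    ≡⟨ *M-entry P (M *M P) a b ⟩
  sum (λ c → entry P a c ∧ entry (M *M P) c b)
    ≡⟨ sum-cong-≗ (λ c → cong₂ _∧_ (P≗T a c) (MP-column c)) ⟩
  sum (λ c → transvection p q a c ∧ Y c)
    ≡⟨ transvection-applyʳ p q Y a ⟩
  Y a xor (p a ∧ ⟨ q , Y ⟩)
    ≡⟨ cong (λ t → Y a xor (p a ∧ t)) ⟨q,Y⟩ ⟩
  Y a xor (p a ∧ ((q b xor (⟨ q , p ⟩ ∧ q b)) xor (⟨ q , u ⟩ ∧ K)))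
    ≡⟨ cong (λ t → Y a xor (p a ∧ ((q b xor (t ∧ q b)) xor (⟨ q , u ⟩ ∧ K)))) q⊥p ⟩
  Y a xor (p a ∧ ((q b xor (false ∧ q b)) xor (⟨ q , u ⟩ ∧ K)))
    ≡⟨ collect (δ a b) (p a) (q b) (u a) ⟨ q , u ⟩ K ⟩
  transvection (λ a → u a xor (⟨ q , u ⟩ ∧ p a)) (λ b → v b xor (⟨ v , p ⟩ ∧ q b)) a b ∎
  where
  open ≡-Reasoning
  K : Bool
  K = v b xor (⟨ v , p ⟩ ∧ q b)
  Y : _ → Bool
  Y c = transvection p q c b xor (u c ∧ K)
  MP-column : ∀ c → entry (M *M P) c b ≡ Y c
  MP-column c = begin
    entry (M *M P) c b
      ≡⟨ *M-entry M P c b ⟩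
    sum (λ d → entry M c d ∧ entry P d b)
      ≡⟨ sum-cong-≗ (λ d → cong₂ _∧_ (M≗T c d) (P≗T d b)) ⟩
    sum (λ d → transvection u v c d ∧ transvection p q d b)
      ≡⟨ transvection-applyʳ u v (λ d → transvection p q d b) c ⟩
    transvection p q c b xor (u c ∧ sum (λ d → v d ∧ transvection p q d b))
      ≡⟨ cong (λ t → transvection p q c b xor (u c ∧ t)) (transvection-applyˡ v p q b) ⟩
    Y c ∎
  ⟨q,Y⟩ : ⟨ q , Y ⟩ ≡ (q b xor (⟨ q , p ⟩ ∧ q b)) xor (⟨ q , u ⟩ ∧ K)
  ⟨q,Y⟩ = trans (⟨⟩-linearʳ q (λ c → transvection p q c b) u K)
                (cong (_xor (⟨ q , u ⟩ ∧ K)) (transvection-applyˡ q p q b))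
  collect : ∀ e pa qb ua α k →
    ((e xor (pa ∧ qb)) xor (ua ∧ k)) xor (pa ∧ ((qb xor (false ∧ qb)) xor (α ∧ k)))
    ≡ e xor ((ua xor (α ∧ pa)) ∧ k)
  collect = solve-∀ F₂

flipMove-transvection : ∀ {n} (G : Graph n) (k : Fin n) →
  flipMove G k HasEntries transvection (λ a → adj G a k) (δ k)
flipMove-transvection G k a b = trans (tabulate-HasEntries _ a b) (entries a b)
  where
  entries : ∀ a b → (δ a b ∨ (δ b k ∧ adj G a b)) ≡ δ a b xor (adj G a k ∧ δ k b)
  entries a b with b ≟ k
  ... | no b≢k rewrite δ-≢ b≢k | δ-≢ (b≢k ∘ sym) | ∧-zeroʳ (adj G a k) =
    trans (∨-identityʳ (δ a b)) (sym (xor-identityʳ (δ a b)))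
  entries a b | yes refl with a ≟ b
  ... | yes refl rewrite δ-refl a | adj-irr G a = refl
  ... | no a≢b   rewrite δ-≢ a≢b | δ-refl b | ∧-identityʳ (adj G a b) = refl

lookup-flipMove-·V : ∀ {n} (G : Graph n) (κ : Fin n) (v : F2Vec n) a →
  lookup (flipMove G κ ·V v) a ≡ lookup v a xor (adj G a κ ∧ lookup v κ)
lookup-flipMove-·V G κ v a = begin
  lookup (flipMove G κ ·V v) a
    ≡⟨ lookup∘tabulate (λ a → Σ₂ (λ b → entry (flipMove G κ) a b ∧ lookup v b)) a ⟩
  Σ₂ (λ b → entry (flipMove G κ) a b ∧ lookup v b)
    ≡⟨ Σ₂≡sum (λ b → entry (flipMove G κ) a b ∧ lookup v b) ⟩
  sum (λ b → entry (flipMove G κ) a b ∧ lookup v b)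
    ≡⟨ sum-cong-≗ (λ b → cong (_∧ lookup v b) (flipMove-transvection G κ a b)) ⟩
  sum (λ b → transvection (λ a → adj G a κ) (δ κ) a b ∧ lookup v b)
    ≡⟨ transvection-applyʳ (λ a → adj G a κ) (δ κ) (lookup v) a ⟩
  lookup v a xor (adj G a κ ∧ ⟨ δ κ , lookup v ⟩)
    ≡⟨ cong (λ t → lookup v a xor (adj G a κ ∧ t)) ⟨δ κ , lookup v ⟩ ⟩
  lookup v a xor (adj G a κ ∧ lookup v κ) ∎
  where open ≡-Reasoning

-- Isomorphisms of flipping groups

Isomorphic-trans : ∀ {n} {G H K : Graph n} → Isomorphic G H → Isomorphic H K → Isomorphic G K
Isomorphic-trans (f , f-in , f-hom , f-inj , f-onto) (g , g-in , g-hom , g-inj , g-onto) =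
  g ∘ f ,
  (λ M M∈ → g-in (f M) (f-in M M∈)) ,
  (λ M N M∈ N∈ → trans (cong g (f-hom M N M∈ N∈)) (g-hom (f M) (f N) (f-in M M∈) (f-in N N∈))) ,
  (λ M N M∈ N∈ gfM≡gfN → f-inj M N M∈ N∈ (g-inj (f M) (f N) (f-in M M∈) (f-in N N∈) gfM≡gfN)) ,
  λ Q Q∈ → let (N , N∈ , gN≡Q) = g-onto Q Q∈ ; (M , M∈ , fM≡N) = f-onto N N∈
           in M , M∈ , trans (cong g fM≡N) gN≡Q

≗-adj⇒Isomorphic : ∀ {n} (G H : Graph n) → (∀ a b → adj G a b ≡ adj H a b) → Isomorphic G H
≗-adj⇒Isomorphic G H G≗H =
  id ,
  (λ M (w , w≡M) → w , trans (cong prodM (sym (map-cong same-flips w))) w≡M) ,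
  (λ _ _ _ _ → refl) ,
  (λ _ _ _ _ M≡N → M≡N) ,
  λ Q (w , w≡Q) → Q , (w , trans (cong prodM (map-cong same-flips w)) w≡Q) , refl
  where
  same-flips : ∀ k → flipMove G k ≡ flipMove H k
  same-flips k = tabulate-cong λ a → tabulate-cong λ b → cong (λ t → δ a b ∨ (δ b k ∧ t)) (G≗H a b)

Isomorphic-refl : ∀ {n} {G : Graph n} → Isomorphic G G
Isomorphic-refl {G = G} = ≗-adj⇒Isomorphic G G λ _ _ → refl

module Conjugation {n} (P : Mat n) (P²≡I : P *M P ≡ idM) where

  conj : Mat n → Mat n
  conj M = P *M (M *M P)

  cancel-P² : ∀ X Y → X *M (P *M (P *M Y)) ≡ X *M Y
  cancel-P² X Y = cong (X *M_) (begin
    P *M (P *M Y)  ≡⟨ sym (*M-assoc P P Y) ⟩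
    (P *M P) *M Y  ≡⟨ cong (_*M Y) P²≡I ⟩
    idM *M Y       ≡⟨ *M-identityˡ Y ⟩
    Y              ∎)
    where open ≡-Reasoning

  conj-*M : ∀ M N → conj (M *M N) ≡ conj M *M conj N
  conj-*M M N = sym (begin
    (P *M (M *M P)) *M (P *M (N *M P)) ≡⟨ *M-assoc P (M *M P) (P *M (N *M P)) ⟩
    P *M ((M *M P) *M (P *M (N *M P))) ≡⟨ cong (P *M_) (*M-assoc M P (P *M (N *M P))) ⟩
    P *M (M *M (P *M (P *M (N *M P)))) ≡⟨ cong (P *M_) (cancel-P² M (N *M P)) ⟩
    P *M (M *M (N *M P))               ≡⟨ cong (P *M_) (sym (*M-assoc M N P)) ⟩
    P *M ((M *M N) *M P)               ∎)
    where open ≡-Reasoning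

  conj-involutive : ∀ M → conj (conj M) ≡ M
  conj-involutive M = begin
    P *M ((P *M (M *M P)) *M P) ≡⟨ cong (P *M_) (*M-assoc P (M *M P) P) ⟩
    P *M (P *M ((M *M P) *M P)) ≡⟨ sym (*M-identityˡ (P *M (P *M ((M *M P) *M P)))) ⟩
    idM *M (P *M (P *M ((M *M P) *M P))) ≡⟨ cancel-P² idM ((M *M P) *M P) ⟩
    idM *M ((M *M P) *M P)      ≡⟨ *M-identityˡ ((M *M P) *M P) ⟩
    (M *M P) *M P               ≡⟨ *M-assoc M P P ⟩
    M *M (P *M P)               ≡⟨ cong (M *M_) P²≡I ⟩
    M *M idM                    ≡⟨ *M-identityʳ M ⟩
    M                           ∎
    where open ≡-Reasoning

  conj-idM : conj idM ≡ idM
  conj-idM = trans (cong (P *M_) (*M-identityˡ P)) P²≡I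

  module _ (G H : Graph n) (τ : Fin n → List (Fin n))
           (conj-flip : ∀ k → conj (flipMove G k) ≡ prodM (map (flipMove H) (τ k))) where

    conj-word : ∀ w → conj (prodM (map (flipMove G) w)) ≡ prodM (map (flipMove H) (concatMap τ w))
    conj-word []      = conj-idM
    conj-word (k ∷ w) = begin
      conj (flipMove G k *M prodM (map (flipMove G) w))
        ≡⟨ conj-*M (flipMove G k) (prodM (map (flipMove G) w)) ⟩
      conj (flipMove G k) *M conj (prodM (map (flipMove G) w))
        ≡⟨ cong₂ _*M_ (conj-flip k) (conj-word w) ⟩
      prodM (map (flipMove H) (τ k)) *M prodM (map (flipMove H) (concatMap τ w))
        ≡⟨ sym (prodM-++ (map (flipMove H) (τ k)) (map (flipMove H) (concatMap τ w))) ⟩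
      prodM (map (flipMove H) (τ k) ++ map (flipMove H) (concatMap τ w))
        ≡⟨ cong prodM (sym (map-++ (flipMove H) (τ k) (concatMap τ w))) ⟩
      prodM (map (flipMove H) (τ k ++ concatMap τ w)) ∎
      where open ≡-Reasoning

    conj-InW : ∀ M → InW G M → InW H (conj M)
    conj-InW M (w , w≡M) = concatMap τ w , trans (sym (conj-word w)) (cong conj w≡M)

  conj-Isomorphic : (G H : Graph n) (τ σ : Fin n → List (Fin n)) →
    (∀ k → conj (flipMove G k) ≡ prodM (map (flipMove H) (τ k))) →
    (∀ k → conj (flipMove H k) ≡ prodM (map (flipMove G) (σ k))) →
    Isomorphic G H
  conj-Isomorphic G H τ σ conj-flipG conj-flipH =
    conj ,
    conj-InW G H τ conj-flipG ,
    (λ M N _ _ → conj-*M M N) ,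
    (λ M N _ _ conjM≡conjN →
       trans (sym (conj-involutive M)) (trans (cong conj conjM≡conjN) (conj-involutive N))) ,
    λ Q Q∈ → conj Q , conj-InW H G σ conj-flipH Q Q∈ , conj-involutive Q

record NeighbourhoodMove {n} (ℓ j : Fin n) (G H : Graph n) : Set where
  field
    j≢ℓ      : j ≢ ℓ
    j~ℓ      : adj G j ℓ ≡ true
    adj-away : ∀ a b → a ≢ ℓ → b ≢ ℓ → adj H a b ≡ adj G a b
    adj-ℓ    : ∀ b → b ≢ ℓ → adj H ℓ b ≡ adj G ℓ b xor adj G j b

module _ {n} {ℓ j : Fin n} {G H : Graph n} (move : NeighbourhoodMove ℓ j G H) where
  open NeighbourhoodMove move

  NeighbourhoodMove-ℓ~j : adj H ℓ j ≡ true
  NeighbourhoodMove-ℓ~j = begin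
    adj H ℓ j                ≡⟨ adj-ℓ j j≢ℓ ⟩
    adj G ℓ j xor adj G j j  ≡⟨ cong₂ _xor_ (trans (adj-sym G ℓ j) j~ℓ) (adj-irr G j) ⟩
    true                     ∎
    where open ≡-Reasoning

  NeighbourhoodMove-sym : NeighbourhoodMove ℓ j H G
  NeighbourhoodMove-sym = record
    { j≢ℓ      = j≢ℓ
    ; j~ℓ      = trans (adj-sym H j ℓ) NeighbourhoodMove-ℓ~j
    ; adj-away = λ a b a≢ℓ b≢ℓ → sym (adj-away a b a≢ℓ b≢ℓ)
    ; adj-ℓ    = λ b b≢ℓ → begin
        adj G ℓ b
          ≡⟨ sym (xor-cancelʳ (adj G ℓ b) (adj G j b)) ⟩
        (adj G ℓ b xor adj G j b) xor adj G j b
          ≡⟨ cong₂ _xor_ (sym (adj-ℓ b b≢ℓ)) (sym (adj-away j b j≢ℓ b≢ℓ)) ⟩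
        adj H ℓ b xor adj H j b ∎
    }
    where open ≡-Reasoning

elementary : ∀ {n} → Fin n → Fin n → Mat n
elementary ℓ j = tabulate λ a → tabulate (transvection (δ ℓ) (δ j) a)

elementary-involutive : ∀ {n} {ℓ j : Fin n} → j ≢ ℓ → elementary ℓ j *M elementary ℓ j ≡ idM
elementary-involutive {ℓ = ℓ} {j} j≢ℓ =
  transvection-involutive {P = elementary ℓ j} (δ ℓ) (δ j) (tabulate-HasEntries _) (⟨δ,δ⟩-≢ j≢ℓ)

-- Conjugation by the elementary matrix sends s_ℓ to s_j s_ℓ s_j and fixes the other generators.
flipImage : ∀ {n} → Fin n → Fin n → Fin n → List (Fin n)
flipImage ℓ j k with k ≟ ℓ
... | yes _ = j ∷ ℓ ∷ j ∷ []
... | no _  = k ∷ []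

module _ {n} {ℓ j : Fin n} {G H : Graph n} (move : NeighbourhoodMove ℓ j G H) where
  open NeighbourhoodMove move

  private
    P : Mat n
    P = elementary ℓ j

    conj-flip-entries : ∀ k → P *M (flipMove G k *M P) HasEntries
      transvection (λ a → adj G a k xor (adj G j k ∧ δ ℓ a)) (λ b → δ k b xor (δ ℓ k ∧ δ j b))
    conj-flip-entries k a b =
      trans (conjugate-transvection {P = P} {M = flipMove G k} (δ ℓ) (δ j) (λ a → adj G a k) (δ k)
                                    (tabulate-HasEntries _) (flipMove-transvection G k) (⟨δ,δ⟩-≢ j≢ℓ) a b)
            (transvection-cong
               (λ a → cong (λ t → adj G a k xor (t ∧ δ ℓ a)) ⟨δ j , (λ c → adj G c k) ⟩)
               (λ b → cong (λ t → δ k b xor (t ∧ δ j b)) ⟨δ k , δ ℓ ⟩) a b)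

    conj-flip-away : ∀ k → k ≢ ℓ → P *M (flipMove G k *M P) ≡ flipMove H k *M idM
    conj-flip-away k k≢ℓ = HasEntries-unique (conj-flip-entries k)
      (λ a b → trans (cong (λ M → entry M a b) (*M-identityʳ (flipMove H k)))
                     (flipMove-transvection H k a b))
      (transvection-cong new-column new-row)
      where
      new-column : ∀ a → adj G a k xor (adj G j k ∧ δ ℓ a) ≡ adj H a k
      new-column a with a ≟ ℓ
      ... | yes refl rewrite δ-refl a | ∧-identityʳ (adj G j k) = sym (adj-ℓ k k≢ℓ)
      ... | no a≢ℓ   rewrite δ-≢ (a≢ℓ ∘ sym) | ∧-zeroʳ (adj G j k) =
        trans (xor-identityʳ (adj G a k)) (sym (adj-away a k a≢ℓ k≢ℓ))
      new-row : ∀ b → δ k b xor (δ ℓ k ∧ δ j b) ≡ δ k b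
      new-row b rewrite δ-≢ (k≢ℓ ∘ sym) = xor-identityʳ (δ k b)

    conj-flip-ℓ : P *M (flipMove G ℓ *M P) ≡ flipMove H j *M (flipMove H ℓ *M (flipMove H j *M idM))
    conj-flip-ℓ = HasEntries-unique (conj-flip-entries ℓ)
      (λ a b → trans (cong (λ M → entry (flipMove H j *M (flipMove H ℓ *M M)) a b)
                           (*M-identityʳ (flipMove H j)))
                     (conjugate-transvection {P = flipMove H j} {M = flipMove H ℓ}
                        (λ a → adj H a j) (δ j) (λ a → adj H a ℓ) (δ ℓ)
                        (flipMove-transvection H j) (flipMove-transvection H ℓ)
                        (trans ⟨δ j , (λ c → adj H c j) ⟩ (adj-irr H j)) a b))
      (transvection-cong new-column new-row)
      where
      ℓ~j : adj H ℓ j ≡ true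
      ℓ~j = NeighbourhoodMove-ℓ~j move
      new-column : ∀ a → adj G a ℓ xor (adj G j ℓ ∧ δ ℓ a)
                       ≡ adj H a ℓ xor (⟨ δ j , (λ c → adj H c ℓ) ⟩ ∧ adj H a j)
      new-column a rewrite ⟨δ j , (λ c → adj H c ℓ) ⟩ | j~ℓ | trans (adj-sym H j ℓ) ℓ~j with a ≟ ℓ
      ... | yes refl rewrite δ-refl a | adj-irr G a | adj-irr H a | ℓ~j = refl
      ... | no a≢ℓ   rewrite δ-≢ (a≢ℓ ∘ sym) = begin
        adj G a ℓ xor false                      ≡⟨ xor-identityʳ (adj G a ℓ) ⟩
        adj G a ℓ                                ≡⟨ sym (xor-cancelʳ (adj G a ℓ) (adj G a j)) ⟩
        (adj G a ℓ xor adj G a j) xor adj G a j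
          ≡⟨ cong₂ (λ x y → (x xor y) xor adj G a j) (adj-sym G a ℓ) (adj-sym G a j) ⟩
        (adj G ℓ a xor adj G j a) xor adj G a j
          ≡⟨ cong₂ _xor_ (sym (trans (adj-sym H a ℓ) (adj-ℓ a a≢ℓ)))
                         (sym (adj-away a j a≢ℓ j≢ℓ)) ⟩
        adj H a ℓ xor adj H a j                  ∎
        where open ≡-Reasoning
      new-row : ∀ b → δ ℓ b xor (δ ℓ ℓ ∧ δ j b)
                    ≡ δ ℓ b xor (⟨ δ ℓ , (λ c → adj H c j) ⟩ ∧ δ j b)
      new-row b rewrite δ-refl ℓ | ⟨δ ℓ , (λ c → adj H c j) ⟩ | ℓ~j = refl

  conj-flip : ∀ k → P *M (flipMove G k *M P) ≡ prodM (map (flipMove H) (flipImage ℓ j k))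
  conj-flip k with k ≟ ℓ
  ... | yes refl = conj-flip-ℓ
  ... | no k≢ℓ   = conj-flip-away k k≢ℓ

NeighbourhoodMove⇒Isomorphic : ∀ {n} {ℓ j : Fin n} {G H : Graph n} →
  NeighbourhoodMove ℓ j G H → Isomorphic G H
NeighbourhoodMove⇒Isomorphic {ℓ = ℓ} {j} {G} {H} move =
  Conjugation.conj-Isomorphic (elementary ℓ j) (elementary-involutive (NeighbourhoodMove.j≢ℓ move)) G H
    (flipImage ℓ j) (flipImage ℓ j) (conj-flip move) (conj-flip (NeighbourhoodMove-sym move))

-- Normal forms

pathAdj : ℕ → ℕ → Bool
pathAdj A B = (B ≡ᵇ suc A) xor (suc B ≡ᵇ A)

pathAdj-sym : ∀ A B → pathAdj A B ≡ pathAdj B A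
pathAdj-sym zero          zero          = refl
pathAdj-sym zero          (suc zero)    = refl
pathAdj-sym zero          (suc (suc B)) = refl
pathAdj-sym (suc zero)    zero          = refl
pathAdj-sym (suc (suc A)) zero          = refl
pathAdj-sym (suc A)       (suc B)       = pathAdj-sym A B

pathAdj-irrefl : ∀ A → pathAdj A A ≡ false
pathAdj-irrefl zero    = refl
pathAdj-irrefl (suc A) = pathAdj-irrefl A

pathAdj-sound : ∀ A B → pathAdj A B ≡ true → A ≡ suc B ⊎ B ≡ suc A
pathAdj-sound zero          (suc zero)    _ = inj₂ refl
pathAdj-sound (suc zero)    zero          _ = inj₁ refl
pathAdj-sound (suc A)       (suc B)       e = Sum.map (cong suc) (cong suc) (pathAdj-sound A B e)
pathAdj-sound zero          zero          ()
pathAdj-sound zero          (suc (suc B)) ()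
pathAdj-sound (suc (suc A)) zero          ()

pathAdj-complete : ∀ A B → A ≡ suc B ⊎ B ≡ suc A → pathAdj A B ≡ true
pathAdj-complete (suc zero)    zero          (inj₁ refl) = refl
pathAdj-complete zero          (suc zero)    (inj₂ refl) = refl
pathAdj-complete (suc A)       (suc B)       A~B         =
  pathAdj-complete A B (Sum.map (cong pred) (cong pred) A~B)
pathAdj-complete (suc (suc A)) zero          (inj₁ ())
pathAdj-complete zero          (suc (suc B)) (inj₂ ())

adj≡pathAdj : ∀ {n} (G : Graph n) → InducedPathPrefix G → ∀ a b →
  suc (toℕ a) < n → suc (toℕ b) < n → adj G a b ≡ pathAdj (toℕ a) (toℕ b)
adj≡pathAdj G path a b a<n b<n =
  ⇔⇒≡ (pathAdj-complete (toℕ a) (toℕ b) ∘ proj₁ (path a b a<n b<n))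
      (proj₂ (path a b a<n b<n) ∘ pathAdj-sound (toℕ a) (toℕ b))

bitAt : ∀ {m} → Vec Bool m → ℕ → Bool
bitAt []      _       = false
bitAt (b ∷ x) zero    = b
bitAt (b ∷ x) (suc k) = bitAt x k

-- The normal form with parity vector x = (c₁, …, cₘ) and c₀ = false: the path 0, …, m - 1 together
-- with the vertex m, adjacent to k < m iff c_k ≠ c_{k+1}.
parity : ∀ {m} → Vec Bool m → ℕ → Bool
parity x = bitAt (false ∷ x)

lastAdj : ∀ {m} → Vec Bool m → ℕ → Bool
lastAdj x k = parity x k xor parity x (suc k)

normalAdj : (m : ℕ) → Vec Bool m → ℕ → ℕ → Bool
normalAdj m x A B =
  if A ≡ᵇ m then (if B ≡ᵇ m then false else lastAdj x B)
            else (if B ≡ᵇ m then lastAdj x A else pathAdj A B)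

normalAdj-sym : ∀ m (x : Vec Bool m) A B → normalAdj m x A B ≡ normalAdj m x B A
normalAdj-sym m x A B with A ≡ᵇ m | B ≡ᵇ m
... | true  | true  = refl
... | true  | false = refl
... | false | true  = refl
... | false | false = pathAdj-sym A B

normalAdj-irrefl : ∀ m (x : Vec Bool m) A → normalAdj m x A A ≡ false
normalAdj-irrefl m x A with A ≡ᵇ m
... | true  = refl
... | false = pathAdj-irrefl A

normalGraph : (m : ℕ) → Vec Bool m → Graph (suc m)
normalGraph m x = record
  { adj     = λ a b → normalAdj m x (toℕ a) (toℕ b)
  ; adj-sym = λ a b → normalAdj-sym m x (toℕ a) (toℕ b)
  ; adj-irr = λ a → normalAdj-irrefl m x (toℕ a)
  }

-- Swapping the entries at positions p and p + 1 of x, i.e. c_{p+1} and c_{p+2}, is the neighbourhood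
-- move at the vertex p + 1.
data Swap : ∀ {m} → Vec Bool m → Vec Bool m → Set where
  here  : ∀ {m a} {xs : Vec Bool m} → Swap (a ∷ not a ∷ xs) (not a ∷ a ∷ xs)
  there : ∀ {m z} {xs ys : Vec Bool m} → Swap xs ys → Swap (z ∷ xs) (z ∷ ys)

position : ∀ {m} {x y : Vec Bool m} → Swap x y → ℕ
position here      = zero
position (there s) = suc (position s)

Swap-sym : ∀ {m} {x y : Vec Bool m} → Swap x y → Swap y x
Swap-sym (here {a = true})  = here
Swap-sym (here {a = false}) = here
Swap-sym (there s)          = there (Swap-sym s)

Swap-position< : ∀ {m} {x y : Vec Bool m} (s : Swap x y) → suc (position s) < m
Swap-position< here      = s≤s (s≤s z≤n)
Swap-position< (there s) = s≤s (Swap-position< s)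

Swap-lastAdj-position : ∀ {m} {x y : Vec Bool m} (s : Swap x y) → lastAdj x (suc (position s)) ≡ true
Swap-lastAdj-position (here {a = a}) = xor-inverseʳ a
Swap-lastAdj-position (there s)      = Swap-lastAdj-position s

Swap-parity : ∀ {m} {x y : Vec Bool m} (s : Swap x y) k →
  parity y k ≡ parity x k xor ((k ≡ᵇ suc (position s)) xor (k ≡ᵇ suc (suc (position s))))
Swap-parity here               zero                = refl
Swap-parity (here {a = true})  (suc zero)          = refl
Swap-parity (here {a = false}) (suc zero)          = refl
Swap-parity (here {a = true})  (suc (suc zero))    = refl
Swap-parity (here {a = false}) (suc (suc zero))    = refl
Swap-parity (here {xs = xs})   (suc (suc (suc k))) = sym (xor-identityʳ (bitAt xs k))
Swap-parity (there s)          zero                = refl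
Swap-parity (there {z = z} s)  (suc zero)          = sym (xor-identityʳ z)
Swap-parity (there s)          (suc (suc k))       = Swap-parity s (suc k)

Swap-lastAdj : ∀ {m} {x y : Vec Bool m} (s : Swap x y) k →
  lastAdj y k ≡ lastAdj x k xor pathAdj (suc (position s)) k
Swap-lastAdj {x = x} {y} s k = begin
  parity y k xor parity y (suc k)
    ≡⟨ cong₂ _xor_ (Swap-parity s k) (Swap-parity s (suc k)) ⟩
  (parity x k xor ((k ≡ᵇ j) xor (k ≡ᵇ suc j)))
    xor (parity x (suc k) xor ((suc k ≡ᵇ j) xor (k ≡ᵇ j)))
    ≡⟨ regroup (parity x k) (parity x (suc k)) (k ≡ᵇ j) (k ≡ᵇ suc j) (suc k ≡ᵇ j) ⟩
  lastAdj x k xor pathAdj j k ∎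
  where
  open ≡-Reasoning
  j : ℕ
  j = suc (position s)
  regroup : ∀ c c′ e e′ e″ →
    (c xor (e xor e′)) xor (c′ xor (e″ xor e)) ≡ (c xor c′) xor (e′ xor e″)
  regroup = solve-∀ F₂

≢fromℕ⇒toℕ≢ : ∀ {m} {a : Fin (suc m)} → a ≢ fromℕ m → toℕ a ≢ m
≢fromℕ⇒toℕ≢ {m} a≢m toℕa≡m = a≢m (toℕ-injective (trans toℕa≡m (sym (toℕ-fromℕ m))))

swapVertex : ∀ {m} {x y : Vec Bool m} → Swap x y → Fin (suc m)
swapVertex s = fromℕ< (m<n⇒m<1+n (Swap-position< s))

Swap⇒NeighbourhoodMove : ∀ {m} {x y : Vec Bool m} (s : Swap x y) →
  NeighbourhoodMove (fromℕ m) (swapVertex s) (normalGraph m x) (normalGraph m y)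
Swap⇒NeighbourhoodMove {m} {x} {y} s = record
  { j≢ℓ      = λ j≡ℓ → <⇒≢ j<m (trans (sym toℕ-j) (trans (cong toℕ j≡ℓ) (toℕ-fromℕ m)))
  ; j~ℓ      = j~ℓ toℕ-j (toℕ-fromℕ m)
  ; adj-away = λ a b a≢ℓ b≢ℓ →
                 away (toℕ a) (toℕ b) (≢fromℕ⇒toℕ≢ a≢ℓ) (≢fromℕ⇒toℕ≢ b≢ℓ)
  ; adj-ℓ    = λ b b≢ℓ → at-ℓ toℕ-j (toℕ-fromℕ m) (toℕ b) (≢fromℕ⇒toℕ≢ b≢ℓ)
  }
  where
  j<m : suc (position s) < m
  j<m = Swap-position< s
  toℕ-j : toℕ (swapVertex s) ≡ suc (position s)
  toℕ-j = toℕ-fromℕ< (m<n⇒m<1+n j<m)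
  j≢ᵇm : (suc (position s) ≡ᵇ m) ≡ false
  j≢ᵇm = ≢⇒≡ᵇ-false (<⇒≢ j<m)
  j~ℓ : ∀ {J L} → J ≡ suc (position s) → L ≡ m → normalAdj m x J L ≡ true
  j~ℓ refl refl rewrite j≢ᵇm | ≡ᵇ-refl m = Swap-lastAdj-position s
  away : ∀ A B → A ≢ m → B ≢ m → normalAdj m y A B ≡ normalAdj m x A B
  away A B A≢m B≢m rewrite ≢⇒≡ᵇ-false A≢m | ≢⇒≡ᵇ-false B≢m = refl
  at-ℓ : ∀ {J L} → J ≡ suc (position s) → L ≡ m →
         ∀ B → B ≢ m → normalAdj m y L B ≡ normalAdj m x L B xor normalAdj m x J B
  at-ℓ refl refl B B≢m rewrite j≢ᵇm | ≡ᵇ-refl m | ≢⇒≡ᵇ-false B≢m = Swap-lastAdj s B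

weight : ∀ {m} → Vec Bool m → ℕ
weight = countᵇ id

canonical : (m w : ℕ) → Vec Bool m
canonical zero    _       = []
canonical (suc m) zero    = false ∷ canonical m zero
canonical (suc m) (suc w) = true ∷ canonical m w

Swaps : ∀ {m} → Vec Bool m → Vec Bool m → Set
Swaps = Star Swap

Swaps-∷ : ∀ {m} z {x y : Vec Bool m} → Swaps x y → Swaps (z ∷ x) (z ∷ y)
Swaps-∷ z = Star.gmap (z ∷_) there

false∷canonical : ∀ {m w} → w ≤ m → Swaps (false ∷ canonical m w) (canonical (suc m) w)
false∷canonical {w = zero}          _         = ε
false∷canonical {suc m} {suc w} (s≤s w≤m) = here ◅ Swaps-∷ true (false∷canonical w≤m)

Swaps-canonical : ∀ {m} (x : Vec Bool m) → Swaps x (canonical m (weight x))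
Swaps-canonical []          = ε
Swaps-canonical (true ∷ x)  = Swaps-∷ true (Swaps-canonical x)
Swaps-canonical (false ∷ x) =
  Swaps-∷ false (Swaps-canonical x) ◅◅ false∷canonical (count≤n (T? ∘ id) x)

sameWeight⇒Swaps : ∀ {m} (x y : Vec Bool m) → weight x ≡ weight y → Swaps x y
sameWeight⇒Swaps {m} x y wx≡wy = Swaps-canonical x ◅◅
  subst (λ w → Swaps (canonical m w) y) (sym wx≡wy) (Star.reverse Swap-sym (Swaps-canonical y))

Swaps⇒Isomorphic : ∀ {m} {x y : Vec Bool m} → Swaps x y → Isomorphic (normalGraph m x) (normalGraph m y)
Swaps⇒Isomorphic {m} {x} ε = Isomorphic-refl {G = normalGraph m x}
Swaps⇒Isomorphic {m} {x} {z} (_◅_ {j = y} s ss) =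
  Isomorphic-trans {G = normalGraph m x} {normalGraph m y} {normalGraph m z}
    (NeighbourhoodMove⇒Isomorphic (Swap⇒NeighbourhoodMove s)) (Swaps⇒Isomorphic ss)

-- Reduction to normal forms

clamp : (m : ℕ) → ℕ → Fin (suc m)
clamp zero    _       = zero
clamp (suc m) zero    = zero
clamp (suc m) (suc k) = suc (clamp m k)

toℕ-clamp : ∀ {m k} → k ≤ m → toℕ (clamp m k) ≡ k
toℕ-clamp {zero}  z≤n       = refl
toℕ-clamp {suc m} z≤n       = refl
toℕ-clamp {suc m} (s≤s k≤m) = cong suc (toℕ-clamp k≤m)

clamp-toℕ : ∀ {m} (a : Fin (suc m)) → clamp m (toℕ a) ≡ a
clamp-toℕ {zero}  zero    = refl
clamp-toℕ {suc m} zero    = refl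
clamp-toℕ {suc m} (suc a) = cong suc (clamp-toℕ a)

toℕ≡ᵇ-true⇒fromℕ : ∀ {m} {c : Fin (suc m)} → (toℕ c ≡ᵇ m) ≡ true → c ≡ fromℕ m
toℕ≡ᵇ-true⇒fromℕ {m} e = toℕ-injective (trans (≡ᵇ-true⇒≡ e) (sym (toℕ-fromℕ m)))

toℕ≡ᵇ-false⇒< : ∀ {m} {c : Fin (suc m)} → (toℕ c ≡ᵇ m) ≡ false → toℕ c < m
toℕ≡ᵇ-false⇒< {c = c} e = ≤∧≢⇒< (toℕ≤pred[n] c) (≡ᵇ-false⇒≢ e)

runningXor : (m : ℕ) → Bool → (ℕ → Bool) → Vec Bool m
runningXor zero    c N = []
runningXor (suc m) c N = (c xor N 0) ∷ runningXor m (c xor N 0) (N ∘ suc)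

runningXor-differences : ∀ m c N k → k < m →
  bitAt (c ∷ runningXor m c N) k xor bitAt (c ∷ runningXor m c N) (suc k) ≡ N k
runningXor-differences (suc m) c N zero    _         = cancel c (N 0)
  where
  cancel : ∀ c n → c xor (c xor n) ≡ n
  cancel = solve-∀ F₂
runningXor-differences (suc m) c N (suc k) (s≤s k<m) =
  runningXor-differences m (c xor N 0) (N ∘ suc) k k<m

paritiesOf : ∀ {m} → Graph (suc m) → Vec Bool m
paritiesOf {m} G = runningXor m false (λ k → adj G (clamp m k) (fromℕ m))

lastAdj-paritiesOf : ∀ {m} (G : Graph (suc m)) (c : Fin (suc m)) → toℕ c < m →
  lastAdj (paritiesOf G) (toℕ c) ≡ adj G c (fromℕ m)
lastAdj-paritiesOf {m} G c c<m =
  trans (runningXor-differences m false _ (toℕ c) c<m) (cong (λ c → adj G c (fromℕ m)) (clamp-toℕ c))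

Hyp⇒normalAdj : ∀ {m} (G : Graph (suc m)) → Hyp G →
  ∀ a b → adj G a b ≡ normalAdj m (paritiesOf G) (toℕ a) (toℕ b)
Hyp⇒normalAdj {m} G (_ , path) a b with toℕ a ≡ᵇ m in a≡ᵇm | toℕ b ≡ᵇ m in b≡ᵇm
... | true  | true  = trans (cong₂ (adj G) (toℕ≡ᵇ-true⇒fromℕ a≡ᵇm) (toℕ≡ᵇ-true⇒fromℕ b≡ᵇm))
                            (adj-irr G (fromℕ m))
... | true  | false = begin
  adj G a b                       ≡⟨ cong (λ c → adj G c b) (toℕ≡ᵇ-true⇒fromℕ a≡ᵇm) ⟩
  adj G (fromℕ m) b               ≡⟨ adj-sym G (fromℕ m) b ⟩
  adj G b (fromℕ m)               ≡⟨ sym (lastAdj-paritiesOf G b (toℕ≡ᵇ-false⇒< b≡ᵇm)) ⟩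
  lastAdj (paritiesOf G) (toℕ b)  ∎
  where open ≡-Reasoning
... | false | true  = trans (cong (adj G a) (toℕ≡ᵇ-true⇒fromℕ b≡ᵇm))
                            (sym (lastAdj-paritiesOf G a (toℕ≡ᵇ-false⇒< a≡ᵇm)))
... | false | false =
  adj≡pathAdj G path a b (s≤s (toℕ≡ᵇ-false⇒< a≡ᵇm)) (s≤s (toℕ≡ᵇ-false⇒< b≡ᵇm))

-- Coordinate A of \overline{k+1} in the normal form: e_{k-1} + e_k on the path (e_{-1} = e_m = 0),
-- plus c_k e_m.
barCoord : (m : ℕ) → Vec Bool m → ℕ → ℕ → Bool
barCoord m x k A = if A ≡ᵇ m then parity x k else ((k ≡ᵇ suc A) xor (k ≡ᵇ A))

barCoord-zero : ∀ m (x : Vec Bool (suc m)) A → (A ≡ᵇ 0) ≡ barCoord (suc m) x 0 A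
barCoord-zero m x zero    = refl
barCoord-zero m x (suc A) with A ≡ᵇ m
... | true  = refl
... | false = refl

barCoord-diagonal : ∀ {m} (x : Vec Bool m) {k} → k < m → barCoord m x k k ≡ true
barCoord-diagonal x {k} k<m
  rewrite ≢⇒≡ᵇ-false (<⇒≢ k<m) | ≢⇒≡ᵇ-false (<⇒≢ (n<1+n k)) | ≡ᵇ-refl k = refl

barCoord-step : ∀ {m} (x : Vec Bool m) {k} A → k < m →
  barCoord m x k A xor (normalAdj m x A k ∧ true) ≡ barCoord m x (suc k) A
barCoord-step {m} x {k} A k<m rewrite ≢⇒≡ᵇ-false (<⇒≢ k<m) with A ≡ᵇ m
... | true  = last (parity x k) (parity x (suc k))
  where
  last : ∀ c c′ → c xor ((c xor c′) ∧ true) ≡ c′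
  last = solve-∀ F₂
... | false = path (k ≡ᵇ suc A) (k ≡ᵇ A) (suc k ≡ᵇ A)
  where
  path : ∀ e e′ e″ → (e xor e′) xor ((e xor e″) ∧ true) ≡ e′ xor e″
  path = solve-∀ F₂

-- The hypothesis c_k = 1 is needed only for n = 2, j = 0, k = 1, where \overline 1 and \overline 2 agree
-- off s_n.
barCoord-separates : ∀ {m} (x : Vec Bool (suc m)) {j k} → j < k → k ≤ suc m → parity x k ≡ true →
  ∃[ A ] A ≤ suc m × barCoord (suc m) x j A ≢ barCoord (suc m) x k A
barCoord-separates {m} x {j} {k} j<k k≤m′ c_k with m≤n⇒m<n∨m≡n k≤m′
... | inj₁ k<m′ = k , k≤m′ , false-true-≢ j-at-k (barCoord-diagonal x k<m′)
  where
  j-at-k : barCoord (suc m) x j k ≡ false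
  j-at-k rewrite ≢⇒≡ᵇ-false (<⇒≢ k<m′) | ≢⇒≡ᵇ-false (<⇒≢ j<k)
               | ≢⇒≡ᵇ-false (<⇒≢ (m<n⇒m<1+n j<k)) = refl
... | inj₂ refl with m≤n⇒m<n∨m≡n (s≤s⁻¹ j<k)
...   | inj₁ j<m = m , n≤1+n m , false-true-≢ j-at-m last-at-m
  where
  j-at-m : barCoord (suc m) x j m ≡ false
  j-at-m rewrite ≢⇒≡ᵇ-false (<⇒≢ (n<1+n m)) | ≢⇒≡ᵇ-false (<⇒≢ j<m)
               | ≢⇒≡ᵇ-false (<⇒≢ (m<n⇒m<1+n j<m)) = refl
  last-at-m : barCoord (suc m) x (suc m) m ≡ true
  last-at-m rewrite ≢⇒≡ᵇ-false (<⇒≢ (n<1+n m)) | ≡ᵇ-refl m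
                  | ≢⇒≡ᵇ-false (<⇒≢ (n<1+n m) ∘ sym) = refl
...   | inj₂ refl with m
...     | zero   = 1 , ≤-refl , false-true-≢ refl c_k
...     | suc m″ = m″ , m≤n⇒m≤1+n (n≤1+n m″) , ≢-sym (false-true-≢ last-at-m″ m-at-m″)
  where
  m″<m′ : m″ < suc (suc m″)
  m″<m′ = m<n⇒m<1+n (n<1+n m″)
  m-at-m″ : barCoord (suc (suc m″)) x (suc m″) m″ ≡ true
  m-at-m″ rewrite ≢⇒≡ᵇ-false (<⇒≢ m″<m′) | ≡ᵇ-refl m″
                | ≢⇒≡ᵇ-false (<⇒≢ (n<1+n m″) ∘ sym) = refl
  last-at-m″ : barCoord (suc (suc m″)) x (suc (suc m″)) m″ ≡ false
  last-at-m″ rewrite ≢⇒≡ᵇ-false (<⇒≢ m″<m′) | ≢⇒≡ᵇ-false (<⇒≢ (n<1+n m″) ∘ sym)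
                   | ≢⇒≡ᵇ-false (<⇒≢ m″<m′ ∘ sym) = refl

eqV-sound : ∀ {n} (u v : F2Vec n) → eqV u v ≡ true → u ≡ v
eqV-sound []          []          _ = refl
eqV-sound (true ∷ u)  (true ∷ v)  e = cong (true ∷_) (eqV-sound u v e)
eqV-sound (false ∷ u) (false ∷ v) e = cong (false ∷_) (eqV-sound u v e)
eqV-sound (true ∷ u)  (false ∷ v) ()
eqV-sound (false ∷ u) (true ∷ v)  ()

any-upTo≡false : ∀ (p : ℕ → Bool) k → (∀ j → j < k → p j ≢ true) → any p (upTo k) ≡ false
any-upTo≡false p k none = ¬-not λ any≡true →
  let j , j<k , p[j] = applyUpTo⁻ id (any⁻ p (upTo k) (Equivalence.from T-≡ any≡true))
  in none j j<k (Equivalence.to T-≡ p[j])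

length-filterᵇ-applyUpTo : ∀ {A : Set} (p : A → Bool) (f : ℕ → A) {n} (y : Vec Bool n) →
  (∀ k → k < n → p (f k) ≡ bitAt y k) → length (filterᵇ p (applyUpTo f n)) ≡ weight y
length-filterᵇ-applyUpTo p f []      _    = refl
length-filterᵇ-applyUpTo p f (b ∷ y) p≗y with p (f 0) | p≗y 0 (s≤s z≤n)
... | true  | refl = cong suc (length-filterᵇ-applyUpTo p (f ∘ suc) y λ k k<n → p≗y (suc k) (s≤s k<n))
... | false | refl = length-filterᵇ-applyUpTo p (f ∘ suc) y λ k k<n → p≗y (suc k) (s≤s k<n)

module _ {m} (x : Vec Bool (suc m)) (G : Graph (suc (suc m)))
         (G-normal : ∀ a b → adj G a b ≡ normalAdj (suc m) x (toℕ a) (toℕ b)) where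

  lookup-barℕ : ∀ k → k ≤ suc m → ∀ a → lookup (barℕ G k) a ≡ barCoord (suc m) x k (toℕ a)
  lookup-barℕ zero    _   a =
    trans (lookup∘tabulate (λ a → toℕ a ≡ᵇ 0) a) (barCoord-zero m x (toℕ a))
  lookup-barℕ (suc k) k<m a = begin
    lookup (flipℕ G k ·V barℕ G k) a
      ≡⟨ cong (λ t → lookup (flipℕ G t ·V barℕ G k) a) (sym toℕ-κ) ⟩
    lookup (flipMove G κ ·V barℕ G k) a
      ≡⟨ lookup-flipMove-·V G κ (barℕ G k) a ⟩
    lookup (barℕ G k) a xor (adj G a κ ∧ lookup (barℕ G k) κ)
      ≡⟨ cong₂ (λ s t → s xor (t ∧ lookup (barℕ G k) κ)) (lookup-barℕ k k≤m a) adj-aκ ⟩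
    barCoord (suc m) x k (toℕ a) xor (normalAdj (suc m) x (toℕ a) k ∧ lookup (barℕ G k) κ)
      ≡⟨ cong (λ t → barCoord (suc m) x k (toℕ a) xor (normalAdj (suc m) x (toℕ a) k ∧ t))
              κ-coordinate ⟩
    barCoord (suc m) x k (toℕ a) xor (normalAdj (suc m) x (toℕ a) k ∧ true)
      ≡⟨ barCoord-step x (toℕ a) k<m ⟩
    barCoord (suc m) x (suc k) (toℕ a) ∎
    where
    open ≡-Reasoning
    k≤m : k ≤ suc m
    k≤m = <⇒≤ k<m
    κ : Fin (suc (suc m))
    κ = clamp (suc m) k
    toℕ-κ : toℕ κ ≡ k
    toℕ-κ = toℕ-clamp k≤m
    adj-aκ : adj G a κ ≡ normalAdj (suc m) x (toℕ a) k
    adj-aκ = trans (G-normal a κ) (cong (normalAdj (suc m) x (toℕ a)) toℕ-κ)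
    κ-coordinate : lookup (barℕ G k) κ ≡ true
    κ-coordinate =
      trans (lookup-barℕ k k≤m κ) (trans (cong (barCoord (suc m) x k) toℕ-κ) (barCoord-diagonal x k<m))

  dot-barℕ-last : ∀ k → k ≤ suc m → dot (barℕ G k) (charVec (suc m)) ≡ parity x k
  dot-barℕ-last k k≤m = begin
    Σ₂ (λ i → lookup (barℕ G k) i ∧ lookup (charVec (suc m)) i)
      ≡⟨ Σ₂≡sum (λ i → lookup (barℕ G k) i ∧ lookup (charVec (suc m)) i) ⟩
    sum (λ i → lookup (barℕ G k) i ∧ lookup (charVec (suc m)) i)
      ≡⟨ sum-cong-≗ (λ i → cong (lookup (barℕ G k) i ∧_) (charVec-last i)) ⟩
    sum (λ i → lookup (barℕ G k) i ∧ δ i (fromℕ (suc m)))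
      ≡⟨ sum-∧-δ (fromℕ (suc m)) (lookup (barℕ G k)) ⟩
    lookup (barℕ G k) (fromℕ (suc m))
      ≡⟨ lookup-barℕ k k≤m (fromℕ (suc m)) ⟩
    barCoord (suc m) x k (toℕ (fromℕ (suc m)))
      ≡⟨ cong (barCoord (suc m) x k) (toℕ-fromℕ (suc m)) ⟩
    barCoord (suc m) x k (suc m)
      ≡⟨ cong (if_then parity x k else ((k ≡ᵇ suc (suc m)) xor (k ≡ᵇ suc m))) (≡ᵇ-refl (suc m)) ⟩
    parity x k ∎
    where
    open ≡-Reasoning
    charVec-last : ∀ i → lookup (charVec (suc m)) i ≡ δ i (fromℕ (suc m))
    charVec-last i =
      trans (lookup∘tabulate (λ a → toℕ a ≡ᵇ suc m) i)
            (cong (toℕ i ≡ᵇ_) (sym (toℕ-fromℕ (suc m))))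

  barℕ-new : ∀ {j k} → j < k → k ≤ suc m → parity x k ≡ true →
    eqV (barℕ G j) (barℕ G k) ≢ true
  barℕ-new {j} {k} j<k k≤m c_k bars≡ =
    let A , A≤m , differs = barCoord-separates x j<k k≤m c_k
        a = clamp (suc m) A
        coordinate : ∀ i → i ≤ suc m → lookup (barℕ G i) a ≡ barCoord (suc m) x i A
        coordinate i i≤m = trans (lookup-barℕ i i≤m a) (cong (barCoord (suc m) x i) (toℕ-clamp A≤m))
    in differs (begin
      barCoord (suc m) x j A  ≡⟨ sym (coordinate j (<⇒≤ (<-≤-trans j<k k≤m))) ⟩
      lookup (barℕ G j) a     ≡⟨ cong (λ v → lookup v a) (eqV-sound (barℕ G j) (barℕ G k) bars≡) ⟩
      lookup (barℕ G k) a     ≡⟨ coordinate k k≤m ⟩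
      barCoord (suc m) x k A  ∎)
    where open ≡-Reasoning

  Pi1Card-normal : Pi1Card G ≡ weight x
  Pi1Card-normal = length-filterᵇ-applyUpTo _ id (false ∷ x) λ k k<n → kept≡parity k (s≤s⁻¹ k<n)
    where
    kept≡parity : ∀ k → k ≤ suc m →
      dot (barℕ G k) (charVec (suc m)) ∧ not (any (λ j → eqV (barℕ G j) (barℕ G k)) (upTo k))
      ≡ parity x k
    kept≡parity k k≤m rewrite dot-barℕ-last k k≤m with parity x k in c_k
    ... | false = refl
    ... | true  = cong not (any-upTo≡false _ k λ j j<k → barℕ-new j<k k≤m c_k)

theorem3p9 : ∀ (n : ℕ) → 2 ≤ n → (S S′ : Graph n) → Hyp S → Hyp S′ →
    Pi1Card S ≡ Pi1Card S′ → Isomorphic S S′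
theorem3p9 (suc (suc m)) (s≤s (s≤s z≤n)) S S′ hyp hyp′ same-Pi1 =
  Isomorphic-trans {G = S} {normal x} {S′} (≗-adj⇒Isomorphic S (normal x) S-normal)
    (Isomorphic-trans {G = normal x} {normal x′} {S′}
      (Swaps⇒Isomorphic (sameWeight⇒Swaps x x′ same-weight))
      (≗-adj⇒Isomorphic (normal x′) S′ λ a b → sym (S′-normal a b)))
  where
  normal : Vec Bool (suc m) → Graph (suc (suc m))
  normal = normalGraph (suc m)
  x x′ : Vec Bool (suc m)
  x  = paritiesOf S
  x′ = paritiesOf S′
  S-normal : ∀ a b → adj S a b ≡ normalAdj (suc m) x (toℕ a) (toℕ b)
  S-normal = Hyp⇒normalAdj S hyp
  S′-normal : ∀ a b → adj S′ a b ≡ normalAdj (suc m) x′ (toℕ a) (toℕ b)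
  S′-normal = Hyp⇒normalAdj S′ hyp′
  same-weight : weight x ≡ weight x′
  same-weight = begin
    weight x    ≡⟨ sym (Pi1Card-normal x S S-normal) ⟩
    Pi1Card S   ≡⟨ same-Pi1 ⟩
    Pi1Card S′  ≡⟨ Pi1Card-normal x′ S′ S′-normal ⟩
    weight x′   ∎
    where open ≡-Reasoning
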